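{- Let $\overrightarrow{G}$ be a bipartite oriented graph, let $(G,\sigma)$ be an associated signed graph of $\overrightarrow{G}$, let $\overrightarrow{G}'$ be an associated oriented graph of $(G,\sigma)$, and let $(G,\sigma')$ be an associated signed graph of $\overrightarrow{G}'$. Then $\overrightarrow{G}$ and $\overrightarrow{G}'$ are push equivalent, and $(G,\sigma)$ and $(G,\sigma')$ are switch equivalent.
   Context: A signed graph $(G,\sigma)$ is a graph with $\sigma:E(G)\to\{+,-\}$. To switch a vertex is to change the signs of all edges incident to it; switching a set switches each vertex once; two signed graphs on $G$ are switch equivalent if one is obtained from the other by switching a vertex set. An oriented graph has no loops and at most one arc between two vertices; to push a vertex is to reverse all arcs incident to it, pushing a set pushes each vertex once, and push equivalent means obtainable by pushing a vertex set. Given a bipartite signed graph $(G,\sigma)$ and a bipartition $V(G)=A\cup B$ into independent sets, an associated oriented graph has the same vertices, each positive edge $uv$ ($u\in A,v\in B$) becomes the arc $uv$ and each negative edge becomes the arc $vu$. Given a bipartite oriented graph and a bipartition $A\cup B$, an associated signed graph has the same underlying graph, an edge being positive if its arc goes from $A$ to $B$ and negative if it goes from $B$ to $A$. Different choices of bipartition give possibly different associated graphs. -}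

module Defs where

open import Data.Nat using (ℕ)
open import Data.Fin using (Fin)
open import Data.Bool using (Bool; true; false; _∨_; if_then_else_)
open import Data.Product using (Σ; _×_; ∃)
open import Relation.Binary.PropositionalEquality using (_≡_; _≢_)

record Graph (n : ℕ) : Set where
  field
    adj     : Fin n → Fin n → Bool
    irrefl  : ∀ v → adj v v ≡ false
    adj-sym : ∀ u v → adj u v ≡ adj v u
open Graph public

data Sign : Set where
  plus minus : Sign

neg : Sign → Sign
neg plus  = minus
neg minus = plus

-- Signed graph (G, σ); the sign of the (undirected) edge uv is sign u v = sign v u.
-- Values of sign on non-edges are irrelevant (all notions below only look at edges).
record SignedGraph (n : ℕ) : Set where
  field
    graph    : Graph n
    sign     : Fin n → Fin n → Sign
    sign-sym : ∀ u v → sign u v ≡ sign v u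
open SignedGraph public

record OrientedGraph (n : ℕ) : Set where
  field
    arc    : Fin n → Fin n → Bool
    noloop : ∀ v → arc v v ≡ false
    asym   : ∀ u v → arc u v ≡ true → arc v u ≡ false
open OrientedGraph public

underlying : ∀ {n} → OrientedGraph n → Graph n
underlying {n} D = record { adj = a ; irrefl = ir ; adj-sym = sy }
  where
  a : Fin n → Fin n → Bool
  a u v = arc D u v ∨ arc D v u
  ir : ∀ v → a v v ≡ false
  ir v rewrite noloop D v = Relation.Binary.PropositionalEquality.refl
  sy : ∀ u v → a u v ≡ a v u
  sy u v = Data.Bool.Properties.∨-comm (arc D u v) (arc D v u)
    where import Data.Bool.Properties

-- A bipartition V = A ∪ B into independent sets, given by part : V → Bool
-- (part v ≡ true means v ∈ A, false means v ∈ B): every edge joins A and B.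
IsBipartition : ∀ {n} → Graph n → (Fin n → Bool) → Set
IsBipartition G part = ∀ u v → adj G u v ≡ true → part u ≢ part v

IsAssocSigned : ∀ {n} → OrientedGraph n → (Fin n → Bool) → SignedGraph n → Set
IsAssocSigned D part S =
  IsBipartition (underlying D) part
  × (∀ u v → adj (graph S) u v ≡ adj (underlying D) u v)
  × (∀ u v → adj (graph S) u v ≡ true → part u ≡ true →
       sign S u v ≡ (if arc D u v then plus else minus))

IsAssocOriented : ∀ {n} → SignedGraph n → (Fin n → Bool) → OrientedGraph n → Set
IsAssocOriented S part D =
  IsBipartition (graph S) part
  × (∀ u v → adj (underlying D) u v ≡ adj (graph S) u v)
  × (∀ u v → adj (graph S) u v ≡ true → part u ≡ true →
       (sign S u v ≡ plus → arc D u v ≡ true)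
       × (sign S u v ≡ minus → arc D v u ≡ true))

-- Pushing the vertex set X (X v ≡ true iff v ∈ X): exactly the arcs with one
-- end in X are reversed (an arc with both ends in X is reversed twice).
pushArc : ∀ {n} → OrientedGraph n → (Fin n → Bool) → Fin n → Fin n → Bool
pushArc D X u v with X u Data.Bool.xor X v
... | false = arc D u v
... | true  = arc D v u

PushEquivalent : ∀ {n} → OrientedGraph n → OrientedGraph n → Set
PushEquivalent {n} D D' = Σ (Fin n → Bool) λ X → ∀ u v → arc D' u v ≡ pushArc D X u v

switchSign : ∀ {n} → SignedGraph n → (Fin n → Bool) → Fin n → Fin n → Sign
switchSign S X u v with X u Data.Bool.xor X v
... | false = sign S u v
... | true  = neg (sign S u v)

SwitchEquivalent : ∀ {n} → SignedGraph n → SignedGraph n → Set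
SwitchEquivalent {n} S S' =
  (∀ u v → adj (graph S') u v ≡ adj (graph S) u v)
  × Σ (Fin n → Bool) λ X → ∀ u v → adj (graph S) u v ≡ true → sign S' u v ≡ switchSign S X u v

-- On an edge uv the sign in an associated signed graph is determined by the side of u
-- and the direction of the arc, and conversely.  Translating through bipartitions p and
-- then q therefore reverses exactly those edges uv with p u ≠ q u, which are the edges
-- with exactly one end in X = A_p ∩ B_q.  So D' is D pushed at X; in the same way S' is
-- S switched at A_q ∩ B_r.
module Submission where

open import Defs
open import Data.Nat using (ℕ)
open import Data.Fin using (Fin)
open import Data.Bool using (Bool; true; false; not; _∧_; _xor_; if_then_else_)
open import Data.Bool.Properties using (¬-not; ∨-conicalˡ; ∨-conicalʳ)
open import Data.Product using (_×_; _,_; proj₁; proj₂)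
open import Function using (_∘_)
open import Relation.Binary.PropositionalEquality

private
  variable
    n : ℕ

part-flip : ∀ (G : Graph n) {part} → IsBipartition G part →
            ∀ {u v} → adj G u v ≡ true → part v ≡ not (part u)
part-flip G bip {u} {v} uv = ¬-not (bip u v uv ∘ sym)

arc-reverse : ∀ (D : OrientedGraph n) {u v} → adj (underlying D) u v ≡ true →
              arc D v u ≡ not (arc D u v)
arc-reverse D {u} {v} uv with arc D u v in uv→
... | true  = asym D u v uv→
... | false = uv

pushArc-edge : ∀ (D : OrientedGraph n) X {u v} → adj (underlying D) u v ≡ true →
               pushArc D X u v ≡ (X u xor X v) xor arc D u v
pushArc-edge D X {u} {v} uv with X u xor X v
... | false = refl
... | true  = arc-reverse D uv

pushArc-nonEdge : ∀ (D : OrientedGraph n) X {u v} → adj (underlying D) u v ≡ false →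
                  pushArc D X u v ≡ false
pushArc-nonEdge D X {u} {v} uv with X u xor X v
... | false = ∨-conicalˡ _ _ uv
... | true  = ∨-conicalʳ _ _ uv

switchSign-xor : ∀ (S : SignedGraph n) X u v →
                 switchSign S X u v ≡ (if X u xor X v then neg (sign S u v) else sign S u v)
switchSign-xor S X u v with X u xor X v
... | false = refl
... | true  = refl

-- assocSign (side of u) (does the arc go u → v): the sign of uv in an associated signed graph.
assocSign : Bool → Bool → Sign
assocSign true  forward = if forward then plus else minus
assocSign false forward = if not forward then plus else minus

-- assocArc (side of u) (sign of uv): does the arc go u → v in an associated oriented graph.
assocArc : Bool → Sign → Bool
assocArc true  plus  = true
assocArc true  minus = false
assocArc false plus  = false
assocArc false minus = true

assocArc-assocSign : ∀ a b forward → assocArc b (assocSign a forward) ≡ (a xor b) xor forward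
assocArc-assocSign true  true  true  = refl
assocArc-assocSign true  true  false = refl
assocArc-assocSign true  false true  = refl
assocArc-assocSign true  false false = refl
assocArc-assocSign false true  true  = refl
assocArc-assocSign false true  false = refl
assocArc-assocSign false false true  = refl
assocArc-assocSign false false false = refl

assocSign-assocArc : ∀ a b s → assocSign b (assocArc a s) ≡ (if a xor b then neg s else s)
assocSign-assocArc true  true  plus  = refl
assocSign-assocArc true  true  minus = refl
assocSign-assocArc true  false plus  = refl
assocSign-assocArc true  false minus = refl
assocSign-assocArc false true  plus  = refl
assocSign-assocArc false true  minus = refl
assocSign-assocArc false false plus  = refl
assocSign-assocArc false false minus = refl

assocSigned-sign : ∀ (D : OrientedGraph n) p S → IsAssocSigned D p S →
                   ∀ {u v} → adj (underlying D) u v ≡ true → sign S u v ≡ assocSign (p u) (arc D u v)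
assocSigned-sign D p S (bip , sameGraph , signs) {u} {v} uv with p u in sideU
... | true  = signs u v (trans (sameGraph u v) uv) sideU
... | false = begin
    sign S u v                  ≡⟨ sign-sym S u v ⟩
    sign S v u                  ≡⟨ signs v u vu v∈A ⟩
    assocSign true (arc D v u)  ≡⟨ cong (assocSign true) (arc-reverse D uv) ⟩
    assocSign false (arc D u v) ∎
  where
  open ≡-Reasoning
  vu : adj (graph S) v u ≡ true
  vu = trans (sameGraph v u) (trans (adj-sym (underlying D) v u) uv)
  v∈A : p v ≡ true
  v∈A = trans (part-flip (underlying D) bip uv) (cong not sideU)

assocOriented-arc : ∀ S q (D : OrientedGraph n) → IsAssocOriented S q D →
                    ∀ {u v} → adj (graph S) u v ≡ true → arc D u v ≡ assocArc (q u) (sign S u v)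
assocOriented-arc S q D (bip , _ , arcs) {u} {v} uv with q u in sideU
... | true  = fromA
  where
  fromA : arc D u v ≡ assocArc true (sign S u v)
  fromA with sign S u v in uv±
  ... | plus  = proj₁ (arcs u v uv sideU) uv±
  ... | minus = asym D v u (proj₂ (arcs u v uv sideU) uv±)
... | false = fromB
  where
  vu : adj (graph S) v u ≡ true
  vu = trans (adj-sym (graph S) v u) uv
  v∈A : q v ≡ true
  v∈A = trans (part-flip (graph S) bip uv) (cong not sideU)
  fromB : arc D u v ≡ assocArc false (sign S u v)
  fromB rewrite sign-sym S u v with sign S v u in vu±
  ... | plus  = asym D v u (proj₁ (arcs v u vu v∈A) vu±)
  ... | minus = proj₂ (arcs v u vu v∈A) vu±

movedOut : (Fin n → Bool) → (Fin n → Bool) → Fin n → Bool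
movedOut p q v = p v ∧ not (q v)

movedOut-xor : ∀ (G : Graph n) {p q} → IsBipartition G p → IsBipartition G q →
               ∀ {u v} → adj G u v ≡ true → movedOut p q u xor movedOut p q v ≡ p u xor q u
movedOut-xor G {p} {q} bipP bipQ {u} {v} uv
  rewrite part-flip G bipP uv | part-flip G bipQ uv with p u | q u
... | true  | true  = refl
... | true  | false = refl
... | false | true  = refl
... | false | false = refl

reassociate-pushEquivalent : ∀ (D : OrientedGraph n) p S q (D' : OrientedGraph n) →
                             IsAssocSigned D p S → IsAssocOriented S q D' → PushEquivalent D D'
reassociate-pushEquivalent D p S q D' assocS@(bipP , sameS , _) assocD'@(bipQ , sameD' , _) =
  movedOut p q , pushed
  where
  pushed : ∀ u v → arc D' u v ≡ pushArc D (movedOut p q) u v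
  pushed u v with adj (underlying D) u v in uv
  ... | false = trans (∨-conicalˡ _ _ (trans (sameD' u v) (trans (sameS u v) uv)))
                      (sym (pushArc-nonEdge D (movedOut p q) uv))
  ... | true  = begin
      arc D' u v                                        ≡⟨ assocOriented-arc S q D' assocD' uvS ⟩
      assocArc (q u) (sign S u v)                       ≡⟨ cong (assocArc (q u)) (assocSigned-sign D p S assocS uv) ⟩
      assocArc (q u) (assocSign (p u) (arc D u v))      ≡⟨ assocArc-assocSign (p u) (q u) (arc D u v) ⟩
      (p u xor q u) xor arc D u v                       ≡⟨ cong (_xor arc D u v) (movedOut-xor (underlying D) bipP bipQ' uv) ⟨
      (movedOut p q u xor movedOut p q v) xor arc D u v ≡⟨ pushArc-edge D (movedOut p q) uv ⟨
      pushArc D (movedOut p q) u v                      ∎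
    where
    open ≡-Reasoning
    uvS : adj (graph S) u v ≡ true
    uvS = trans (sameS u v) uv
    bipQ' : IsBipartition (underlying D) q
    bipQ' x y xy = bipQ x y (trans (sameS x y) xy)

reassociate-switchEquivalent : ∀ S q (D' : OrientedGraph n) r S' →
                               IsAssocOriented S q D' → IsAssocSigned D' r S' → SwitchEquivalent S S'
reassociate-switchEquivalent S q D' r S' assocD'@(bipQ , sameD' , _) assocS'@(bipR , sameS' , _) =
  (λ u v → trans (sameS' u v) (sameD' u v)) , movedOut q r , switched
  where
  switched : ∀ u v → adj (graph S) u v ≡ true → sign S' u v ≡ switchSign S (movedOut q r) u v
  switched u v uv = begin
      sign S' u v                                   ≡⟨ assocSigned-sign D' r S' assocS' uvD' ⟩
      assocSign (r u) (arc D' u v)                  ≡⟨ cong (assocSign (r u)) (assocOriented-arc S q D' assocD' uv) ⟩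
      assocSign (r u) (assocArc (q u) (sign S u v)) ≡⟨ assocSign-assocArc (q u) (r u) (sign S u v) ⟩
      flipIf (q u xor r u)                          ≡⟨ cong flipIf (movedOut-xor (graph S) bipQ bipR' uv) ⟨
      flipIf (movedOut q r u xor movedOut q r v)    ≡⟨ switchSign-xor S (movedOut q r) u v ⟨
      switchSign S (movedOut q r) u v               ∎
    where
    open ≡-Reasoning
    flipIf : Bool → Sign
    flipIf b = if b then neg (sign S u v) else sign S u v
    uvD' : adj (underlying D') u v ≡ true
    uvD' = trans (sameD' u v) uv
    bipR' : IsBipartition (graph S) r
    bipR' x y xy = bipR x y (trans (sameD' x y) xy)

mainTheorem8 : (n : ℕ) (D : OrientedGraph n) (S : SignedGraph n) (D' : OrientedGraph n) (S' : SignedGraph n)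
               (p q r : Fin n → Bool) →
               IsAssocSigned D p S → IsAssocOriented S q D' → IsAssocSigned D' r S' →
               PushEquivalent D D' × SwitchEquivalent S S'
mainTheorem8 n D S D' S' p q r assocS assocD' assocS' =
  reassociate-pushEquivalent D p S q D' assocS assocD' ,
  reassociate-switchEquivalent S q D' r S' assocD' assocS'
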